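{- The class $\mathrm{Age}(C_3[I_\omega]^*)$ has the expansion property relative to $\mathrm{Age}(C_3[I_\omega])$.
   Context: $C_3$ is the 3-cycle tournament on $\{0,1,2\}$ with edges $0\to1$, $1\to2$, $2\to0$. $C_3[I_\omega]$ is the directed graph on $\{0,1,2\}\times\mathbb N$ with $E((x,i),(y,j))$ iff $(x,y)$ is an edge of $C_3$. $C_3[I_\omega]^*$ expands it by unary predicates $P_x=\{(x,j):j\in\mathbb N\}$ ($x\in\{0,1,2\}$) and a linear order $<$ with $P_0<P_1<P_2$ whose restriction to each $P_x$ is dense without endpoints. If $\mathcal K^*$ is a class of expansions of members of $\mathcal K$, it has the expansion property relative to $\mathcal K$ if for every $\mathbf A\in\mathcal K$ there is $\mathbf B\in\mathcal K$ such that every expansion of $\mathbf A$ in $\mathcal K^*$ embeds in every expansion of $\mathbf B$ in $\mathcal K^*$. The age of a structure is the class of finite structures embeddable in it. -}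

module Defs where

open import Data.Nat using (ℕ)
open import Data.Fin using (Fin; zero; suc)
import Data.Fin as F
open import Data.Rational using (ℚ)
import Data.Rational as Q
open import Data.Product using (Σ; _×_; _,_; proj₁)
open import Data.Sum using (_⊎_)
open import Data.Unit using (⊤)
open import Data.Empty using (⊥)
open import Function.Bundles using (_⇔_)
open import Function.Definitions using (Injective)
open import Relation.Binary.PropositionalEquality using (_≡_)

record Digraph : Set₁ where
  field
    V : Set
    E : V → V → Set

record ExpData (V : Set) : Set₁ where
  field
    P  : Fin 3 → V → Set
    Lt : V → V → Set

record Digraph* : Set₁ where
  field
    V  : Set
    E  : V → V → Set
    P  : Fin 3 → V → Set
    Lt : V → V → Set

expand : (A : Digraph) → ExpData (Digraph.V A) → Digraph*
expand A d = record
  { V = Digraph.V A ; E = Digraph.E A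
  ; P = ExpData.P d ; Lt = ExpData.Lt d }

Embedding : Digraph → Digraph → Set
Embedding A B =
  Σ (Digraph.V A → Digraph.V B) λ f →
    Injective _≡_ _≡_ f ×
    (∀ x y → Digraph.E A x y ⇔ Digraph.E B (f x) (f y))

Embedding* : Digraph* → Digraph* → Set
Embedding* A B =
  Σ (Digraph*.V A → Digraph*.V B) λ f →
    Injective _≡_ _≡_ f ×
    (∀ x y → Digraph*.E A x y ⇔ Digraph*.E B (f x) (f y)) ×
    (∀ i x → Digraph*.P A i x ⇔ Digraph*.P B i (f x)) ×
    (∀ x y → Digraph*.Lt A x y ⇔ Digraph*.Lt B (f x) (f y))

-- Finite structures: carrier Fin n (every finite structure is
-- isomorphic to one of these).

FinDigraph : Set₁
FinDigraph = Σ ℕ λ n → (Fin n → Fin n → Set)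

toDigraph : FinDigraph → Digraph
toDigraph (n , E) = record { V = Fin n ; E = E }

InAge : Digraph → FinDigraph → Set
InAge M A = Embedding (toDigraph A) M

InAge* : Digraph* → (A : FinDigraph) → ExpData (Fin (proj₁ A)) → Set
InAge* M A d = Embedding* (expand (toDigraph A) d) M

C3Edge : Fin 3 → Fin 3 → Set
C3Edge zero (suc zero) = ⊤
C3Edge (suc zero) (suc (suc zero)) = ⊤
C3Edge (suc (suc zero)) zero = ⊤
C3Edge _ _ = ⊥

C3Iω : Digraph
C3Iω = record
  { V = Fin 3 × ℕ
  ; E = λ { (x , _) (y , _) → C3Edge x y } }

-- The copy of ℕ in each part P_x carries a dense linear
-- order without endpoints; by Cantor's theorem it is isomorphic to
-- (ℚ,<), so we realise the structure on {0,1,2} × ℚ with P_x = {x} × ℚ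
-- and the lexicographic order (so P₀ < P₁ < P₂).
C3Iω* : Digraph*
C3Iω* = record
  { V  = Fin 3 × ℚ
  ; E  = λ { (x , _) (y , _) → C3Edge x y }
  ; P  = λ { i (x , _) → i ≡ x }
  ; Lt = λ { (x , p) (y , q) → x F.< y ⊎ (x ≡ y × p Q.< q) } }

ExpansionProperty : Set₁
ExpansionProperty =
  (A : FinDigraph) → InAge C3Iω A →
  Σ FinDigraph λ B → InAge C3Iω B ×
    ((a : ExpData (Fin (proj₁ A))) →
     (b : ExpData (Fin (proj₁ B))) →
     InAge* C3Iω* A a → InAge* C3Iω* B b →
     Embedding* (expand (toDigraph A) a) (expand (toDigraph B) b))

module Submission where

-- Given A of size n, take B = C₃[I_{n+1}]: three parts ("columns") of
-- n+1 pairwise non-adjacent points each.  Fix admissible expansions of A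
-- and B, i.e. embeddings into C₃[I_ω]^* = {0,1,2} × ℚ; we only use their
-- labels (part, rational).  Since an edge-preserving map into a blow-up
-- of the tournament C₃ preserves and reflects "same part", each column j
-- of B lands in a single part σ j, and σ is a permutation of {0,1,2}.
-- Inside a part, points are ordered by their rational label; we measure
-- positions by ranks (number of smaller points in the same part).  Column
-- j of B is a chain of n+1 points, so its ranks are exactly 0,…,n, while
-- every rank in A is < n.  Hence x ↦ (the point of column σ⁻¹(part x)
-- with the same rank as x) preserves parts and the in-part order, which
-- is all that the relations E, P and < of C₃[I_ω]^* depend on.

open import Defs
open import Data.Nat as ℕ using (ℕ; zero; suc)
import Data.Nat.Properties as ℕP
open import Data.Fin as F using (Fin; zero; suc; toℕ; fromℕ<; combine; remQuot; punchOut)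
import Data.Fin.Properties as FP
open import Data.Fin.Subset using (Subset; _∈_; ⊤; ∣_∣)
open import Data.Fin.Subset.Properties using (p⊂q⇒∣p∣<∣q∣; ∣⊤∣≡n; ∈⊤; ⊆⊤)
open import Data.Vec using (tabulate)
open import Data.Vec.Properties using (lookup∘tabulate; lookup⇒[]=; []=⇒lookup)
open import Data.Rational as ℚ using (ℚ)
import Data.Rational.Properties as ℚP
open import Data.Product using (∃; _×_; _,_; proj₁; proj₂; uncurry)
open import Data.Product.Properties using (×-≡,≡→≡)
open import Data.Sum using (_⊎_; inj₁; inj₂)
open import Data.Sum.Function.Propositional using (_⊎-⇔_)
open import Data.Unit using (tt)
open import Data.Empty using (⊥-elim)
open import Data.Bool.Properties using (T-≡)
open import Relation.Nullary using (¬_; yes; no; isYes)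
open import Relation.Nullary.Decidable using (toWitness; fromWitness; _×-dec_)
open import Relation.Binary using (Decidable; Transitive)
open import Relation.Binary.Definitions using (tri<; tri≈; tri>)
open import Relation.Binary.PropositionalEquality
open import Function using (_∘_; id)
open import Function.Bundles using (_⇔_; mk⇔; Equivalence)
open import Function.Definitions using (Injective)
open import Function.Construct.Composition using (_⇔-∘_)
open import Function.Construct.Symmetry using (⇔-sym)

open Equivalence using (to; from)

-- An injective endomap r of Fin n is onto: if t were missed, punching t
-- out of the codomain would squeeze Fin n injectively into Fin (n - 1).
injective⇒surjective : ∀ {n} (r : Fin n → Fin n) → Injective _≡_ _≡_ r →
                       ∀ t → ∃ λ k → r k ≡ t
injective⇒surjective {zero} r inj ()
injective⇒surjective {suc m} r inj t with FP.any? (λ k → r k F.≟ t)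
... | yes hit = hit
... | no miss =
  let i , j , i<j , same = FP.pigeonhole (ℕP.n<1+n m) (λ k → punchOut (avoids k))
  in ⊥-elim (FP.<-irrefl (inj (FP.punchOut-injective (avoids i) (avoids j) same)) i<j)
  where
  avoids : ∀ k → t ≢ r k
  avoids k e = miss (k , sym e)

Comparable : {X : Set} → (X → X → Set) → X → X → Set
Comparable _≺_ u v = u ≺ v ⊎ u ≡ v ⊎ v ≺ u

module Rank {X : Set} {_≺_ : X → X → Set} (_≺?_ : Decidable _≺_)
            (≺-trans : Transitive _≺_) (≺-irrefl : ∀ {u} → ¬ u ≺ u)
            {n : ℕ} (g : Fin n → X) where

  downset : X → Subset n
  downset u = tabulate λ k → isYes (g k ≺? u)

  below : Fin n → Subset n
  below x = downset (g x)

  ∈-below : ∀ {k x} → g k ≺ g x → k ∈ below x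
  ∈-below {k} {x} k≺x = lookup⇒[]= k (below x)
    (trans (lookup∘tabulate _ k) (to T-≡ (fromWitness k≺x)))

  ∈-below⁻ : ∀ {k x} → k ∈ below x → g k ≺ g x
  ∈-below⁻ {k} {x} k∈ = toWitness {a? = g k ≺? g x} (from T-≡
    (trans (sym (lookup∘tabulate _ k)) ([]=⇒lookup k∈)))

  ∉-below-self : ∀ x → ¬ x ∈ below x
  ∉-below-self x = ≺-irrefl ∘ ∈-below⁻

  rank : Fin n → ℕ
  rank x = ∣ below x ∣

  rank<n : ∀ x → rank x ℕ.< n
  rank<n x = subst (rank x ℕ.<_) (∣⊤∣≡n n)
    (p⊂q⇒∣p∣<∣q∣ (⊆⊤ , x , ∈⊤ , ∉-below-self x))

  rank-mono : ∀ {x y} → g x ≺ g y → rank x ℕ.< rank y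
  rank-mono {x} {y} x≺y = p⊂q⇒∣p∣<∣q∣ (below-⊆ , x , ∈-below x≺y , ∉-below-self x)
    where
    below-⊆ : ∀ {k} → k ∈ below x → k ∈ below y
    below-⊆ k∈ = ∈-below (≺-trans (∈-below⁻ k∈) x≺y)

  rank-reflects : ∀ {x y} → Comparable _≺_ (g x) (g y) → rank x ℕ.< rank y → g x ≺ g y
  rank-reflects (inj₁ x≺y) _ = x≺y
  rank-reflects {x} {y} (inj₂ (inj₁ gx≡gy)) r< =
    ⊥-elim (ℕP.<-irrefl (cong (∣_∣ ∘ downset) gx≡gy) r<)
  rank-reflects (inj₂ (inj₂ y≺x)) r< = ⊥-elim (ℕP.<-asym r< (rank-mono y≺x))

  rank-injective : Injective _≡_ _≡_ g →
                   ∀ {x y} → Comparable _≺_ (g x) (g y) → rank x ≡ rank y → x ≡ y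
  rank-injective _ (inj₁ x≺y) r≡ = ⊥-elim (ℕP.<-irrefl r≡ (rank-mono x≺y))
  rank-injective g-inj (inj₂ (inj₁ gx≡gy)) _ = g-inj gx≡gy
  rank-injective _ (inj₂ (inj₂ y≺x)) r≡ = ⊥-elim (ℕP.<-irrefl (sym r≡) (rank-mono y≺x))

  rank-onto : Injective _≡_ _≡_ g → (∀ x y → Comparable _≺_ (g x) (g y)) →
              ∀ {r} → r ℕ.< n → ∃ λ k → rank k ≡ r
  rank-onto g-inj chain {r} r<n =
    let k , hit = injective⇒surjective rankF rankF-injective (fromℕ< r<n)
    in k , (begin
      rank k                 ≡⟨ sym (FP.toℕ-fromℕ< (rank<n k)) ⟩
      toℕ (rankF k)          ≡⟨ cong toℕ hit ⟩
      toℕ (fromℕ< r<n)       ≡⟨ FP.toℕ-fromℕ< r<n ⟩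
      r                      ∎)
    where
    open ≡-Reasoning
    rankF : Fin n → Fin n
    rankF k = fromℕ< (rank<n k)
    rankF-injective : Injective _≡_ _≡_ rankF
    rankF-injective {x} {y} e = rank-injective g-inj (chain x y)
      (FP.fromℕ<-injective _ _ (rank<n x) (rank<n y) e)

subst₂-⇔ : ∀ {A B : Set} (R : A → B → Set) {a a′ b b′} →
           a ≡ a′ → b ≡ b′ → R a b ⇔ R a′ b′
subst₂-⇔ R refl refl = mk⇔ id id

-- In the tournament C₃ two vertices coincide exactly when there is no
-- edge between them; so maps preserving and reflecting C₃-edges also
-- preserve and reflect equality.
c3-irrefl : ∀ i → ¬ C3Edge i i
c3-irrefl zero ()
c3-irrefl (suc zero) ()
c3-irrefl (suc (suc zero)) ()

c3-total : ∀ i j → i ≢ j → C3Edge i j ⊎ C3Edge j i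
c3-total zero zero i≢j = ⊥-elim (i≢j refl)
c3-total zero (suc zero) _ = inj₁ tt
c3-total zero (suc (suc zero)) _ = inj₂ tt
c3-total (suc zero) zero _ = inj₂ tt
c3-total (suc zero) (suc zero) i≢j = ⊥-elim (i≢j refl)
c3-total (suc zero) (suc (suc zero)) _ = inj₁ tt
c3-total (suc (suc zero)) zero _ = inj₁ tt
c3-total (suc (suc zero)) (suc zero) _ = inj₂ tt
c3-total (suc (suc zero)) (suc (suc zero)) i≢j = ⊥-elim (i≢j refl)

edges-transfer-≡ : ∀ {a b c d} → (C3Edge a b ⇔ C3Edge c d) → (C3Edge b a ⇔ C3Edge d c) →
                   a ≡ b → c ≡ d
edges-transfer-≡ {a} {c = c} {d} ab⇔cd ba⇔dc refl with c F.≟ d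
... | yes c≡d = c≡d
... | no c≢d with c3-total c d c≢d
...   | inj₁ cd = ⊥-elim (c3-irrefl a (from ab⇔cd cd))
...   | inj₂ dc = ⊥-elim (c3-irrefl a (from ba⇔dc dc))

-- Points of C₃[I_ω]^* are labels (part, rational).  u ≺ v says that u
-- and v lie in the same part and u is below v there; the order < of
-- C₃[I_ω]^* is "in a lower part, or ≺".
Label : Set
Label = Fin 3 × ℚ

part : Label → Fin 3
part = proj₁

_≺_ : Label → Label → Set
u ≺ v = part u ≡ part v × proj₂ u ℚ.< proj₂ v

_≺?_ : Decidable _≺_
u ≺? v = (part u F.≟ part v) ×-dec (proj₂ u ℚP.<? proj₂ v)

≺-trans : Transitive _≺_
≺-trans (e , l) (e′ , l′) = trans e e′ , ℚP.<-trans l l′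

≺-irrefl : ∀ {u} → ¬ u ≺ u
≺-irrefl (_ , l) = ℚP.<-irrefl refl l

same-part⇒comparable : ∀ {u v} → part u ≡ part v → Comparable _≺_ u v
same-part⇒comparable {u} {v} e with ℚP.<-cmp (proj₂ u) (proj₂ v)
... | tri< l _ _ = inj₁ (e , l)
... | tri≈ _ q≡ _ = inj₂ (inj₁ (×-≡,≡→≡ (e , q≡)))
... | tri> _ _ l = inj₂ (inj₂ (sym e , l))

module LabelRank = Rank _≺?_ ≺-trans ≺-irrefl

lex-cong : ∀ {u v u′ v′} → part u ≡ part u′ → part v ≡ part v′ → (u ≺ v ⇔ u′ ≺ v′) →
           Digraph*.Lt C3Iω* u v ⇔ Digraph*.Lt C3Iω* u′ v′
lex-cong pu pv ≺⇔ = subst₂-⇔ F._<_ pu pv ⊎-⇔ ≺⇔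

-- A map between finite substructures of C₃[I_ω]^* is an embedding as soon
-- as it is injective and, on labels, preserves parts and preserves and
-- reflects ≺: the relations E, P_i and < of C₃[I_ω]^* depend on nothing
-- else.
labels⇒embedding :
  ∀ {A B : FinDigraph} {a : ExpData (Fin (proj₁ A))} {b : ExpData (Fin (proj₁ B))}
  (ea : InAge* C3Iω* A a) (eb : InAge* C3Iω* B b) (f : Fin (proj₁ A) → Fin (proj₁ B)) →
  Injective _≡_ _≡_ f →
  (∀ x → part (proj₁ eb (f x)) ≡ part (proj₁ ea x)) →
  (∀ x y → proj₁ ea x ≺ proj₁ ea y ⇔ proj₁ eb (f x) ≺ proj₁ eb (f y)) →
  Embedding* (expand (toDigraph A) a) (expand (toDigraph B) b)
labels⇒embedding {_ , EA} {_ , EB} {a} {b} (ga , _ , eA , pA , ltA) (gb , _ , eB , pB , ltB)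
  f f-injective f-part f-≺ = f , f-injective , edges , predicates , order
  where
  sym-part : ∀ x → part (ga x) ≡ part (gb (f x))
  sym-part x = sym (f-part x)

  edges : ∀ x y → EA x y ⇔ EB (f x) (f y)
  edges x y = ⇔-sym (eB (f x) (f y))
    ⇔-∘ (subst₂-⇔ C3Edge (sym-part x) (sym-part y) ⇔-∘ eA x y)

  predicates : ∀ i x → ExpData.P a i x ⇔ ExpData.P b i (f x)
  predicates i x = ⇔-sym (pB i (f x)) ⇔-∘ (subst₂-⇔ _≡_ refl (sym-part x) ⇔-∘ pA i x)

  order : ∀ x y → ExpData.Lt a x y ⇔ ExpData.Lt b (f x) (f y)
  order x y = ⇔-sym (ltB (f x) (f y))
    ⇔-∘ (lex-cong (sym-part x) (sym-part y) (f-≺ x y) ⇔-∘ ltA x y)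

-- The blow-up C₃[I_N] on Fin (3·N): the point combine j k is the k-th
-- point of column j, and there is an edge between two points exactly when
-- there is one between their columns.
column : ∀ N → Fin (3 ℕ.* N) → Fin 3
column N y = proj₁ (remQuot {3} N y)

column-combine : ∀ {N} j (k : Fin N) → column N (combine j k) ≡ j
column-combine j k = cong proj₁ (FP.remQuot-combine j k)

C3Blowup : ℕ → FinDigraph
C3Blowup N = 3 ℕ.* N , λ y y′ → C3Edge (column N y) (column N y′)

C3Blowup∈Age : ∀ N → InAge C3Iω (C3Blowup N)
C3Blowup∈Age N = position , position-injective , λ _ _ → mk⇔ id id
  where
  position : Fin (3 ℕ.* N) → Fin 3 × ℕ
  position y = column N y , toℕ (proj₂ (remQuot {3} N y))

  position-injective : Injective _≡_ _≡_ position
  position-injective {y} {y′} e = begin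
    y                                  ≡⟨ FP.combine-remQuot {3} N y ⟨
    uncurry combine (remQuot {3} N y)  ≡⟨ cong (uncurry combine) same-remQuot ⟩
    uncurry combine (remQuot {3} N y′) ≡⟨ FP.combine-remQuot {3} N y′ ⟩
    y′                                 ∎
    where
    open ≡-Reasoning
    same-remQuot : remQuot {3} N y ≡ remQuot {3} N y′
    same-remQuot = ×-≡,≡→≡ (cong proj₁ e , FP.toℕ-injective (cong proj₂ e))

module Construction {n : ℕ} {EA : Fin n → Fin n → Set}
  {a : ExpData (Fin n)} {b : ExpData (Fin (3 ℕ.* suc n))}
  (ea : InAge* C3Iω* (n , EA) a) (eb : InAge* C3Iω* (C3Blowup (suc n)) b) where

  ga : Fin n → Label
  ga = proj₁ ea

  ga-injective : Injective _≡_ _≡_ ga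
  ga-injective = proj₁ (proj₂ ea)

  gb : Fin (3 ℕ.* suc n) → Label
  gb = proj₁ eb

  same-column⇔same-part : ∀ y y′ →
    column (suc n) y ≡ column (suc n) y′ ⇔ part (gb y) ≡ part (gb y′)
  same-column⇔same-part y y′ = mk⇔
    (edges-transfer-≡ (edge y y′) (edge y′ y))
    (edges-transfer-≡ (⇔-sym (edge y y′)) (⇔-sym (edge y′ y)))
    where
    edge : ∀ y y′ → C3Edge (column (suc n) y) (column (suc n) y′) ⇔ C3Edge (part (gb y)) (part (gb y′))
    edge = proj₁ (proj₂ (proj₂ eb))

  chain : Fin 3 → Fin (suc n) → Label
  chain j k = gb (combine j k)

  chain-same-part : ∀ j k k′ → part (chain j k) ≡ part (chain j k′)
  chain-same-part j k k′ = to (same-column⇔same-part (combine j k) (combine j k′))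
    (trans (column-combine j k) (sym (column-combine j k′)))

  chain-comparable : ∀ j k k′ → Comparable _≺_ (chain j k) (chain j k′)
  chain-comparable j k k′ = same-part⇒comparable (chain-same-part j k k′)

  chain-injective : ∀ j → Injective _≡_ _≡_ (chain j)
  chain-injective j {k} {k′} e = FP.combine-injectiveʳ j k j k′ (proj₁ (proj₂ eb) e)

  base : Fin (suc n)
  base = zero

  σ : Fin 3 → Fin 3
  σ j = part (chain j base)

  σ-injective : Injective _≡_ _≡_ σ
  σ-injective {j} {j′} e = begin
    j                                ≡⟨ column-combine j base ⟨
    column (suc n) (combine j base)  ≡⟨ from (same-column⇔same-part (combine j base) (combine j′ base)) e ⟩
    column (suc n) (combine j′ base) ≡⟨ column-combine j′ base ⟩
    j′                               ∎
    where open ≡-Reasoning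

  τ : Fin 3 → Fin 3
  τ i = proj₁ (injective⇒surjective σ σ-injective i)

  σ∘τ : ∀ i → σ (τ i) ≡ i
  σ∘τ i = proj₂ (injective⇒surjective σ σ-injective i)

  rankA : Fin n → ℕ
  rankA = LabelRank.rank ga

  rankB : Fin 3 → Fin (suc n) → ℕ
  rankB j = LabelRank.rank (chain j)

  -- the point of column j having the same rank as x; it exists because a
  -- column is a chain of n + 1 points while every rank in A is below n
  match : Fin 3 → Fin n → Fin (suc n)
  match j x = proj₁ (LabelRank.rank-onto (chain j) (chain-injective j) (chain-comparable j)
                       (ℕP.m<n⇒m<1+n (LabelRank.rank<n ga x)))

  match-rank : ∀ j x → rankB j (match j x) ≡ rankA x
  match-rank j x = proj₂ (LabelRank.rank-onto (chain j) (chain-injective j) (chain-comparable j)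
                            (ℕP.m<n⇒m<1+n (LabelRank.rank<n ga x)))

  match-≺ : ∀ {x y} → part (ga x) ≡ part (ga y) →
            ∀ j → ga x ≺ ga y ⇔ chain j (match j x) ≺ chain j (match j y)
  match-≺ {x} {y} same j = mk⇔ forward backward
    where
    forward : ga x ≺ ga y → chain j (match j x) ≺ chain j (match j y)
    forward x≺y = LabelRank.rank-reflects (chain j) (chain-comparable j _ _)
      (subst₂ ℕ._<_ (sym (match-rank j x)) (sym (match-rank j y)) (LabelRank.rank-mono ga x≺y))

    backward : chain j (match j x) ≺ chain j (match j y) → ga x ≺ ga y
    backward mx≺my = LabelRank.rank-reflects ga (same-part⇒comparable same)
      (subst₂ ℕ._<_ (match-rank j x) (match-rank j y) (LabelRank.rank-mono (chain j) mx≺my))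

  f : Fin n → Fin (3 ℕ.* suc n)
  f x = combine (τ (part (ga x))) (match (τ (part (ga x))) x)

  f-at : ∀ {x i} → part (ga x) ≡ i → f x ≡ combine (τ i) (match (τ i) x)
  f-at {x} = cong λ i → combine (τ i) (match (τ i) x)

  f-part : ∀ x → part (gb (f x)) ≡ part (ga x)
  f-part x = trans (chain-same-part (τ (part (ga x))) _ base) (σ∘τ (part (ga x)))

  f-same-part : ∀ {x y} → part (gb (f x)) ≡ part (gb (f y)) → part (ga x) ≡ part (ga y)
  f-same-part {x} {y} e = trans (sym (f-part x)) (trans e (f-part y))

  f-≺ : ∀ x y → ga x ≺ ga y ⇔ gb (f x) ≺ gb (f y)
  f-≺ x y = mk⇔ (λ x≺y → to (in-one-column (proj₁ x≺y)) x≺y)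
                (λ fx≺fy → from (in-one-column (f-same-part (proj₁ fx≺fy))) fx≺fy)
    where
    in-one-column : part (ga x) ≡ part (ga y) → ga x ≺ ga y ⇔ gb (f x) ≺ gb (f y)
    in-one-column same =
      subst₂-⇔ _≺_ (cong gb (sym (f-at same))) (cong gb (sym (f-at refl)))
        ⇔-∘ match-≺ same (τ (part (ga y)))

  f-injective : Injective _≡_ _≡_ f
  f-injective {x} {y} fx≡fy =
    LabelRank.rank-injective ga ga-injective (same-part⇒comparable same) same-rank
    where
    same : part (ga x) ≡ part (ga y)
    same = f-same-part (cong (part ∘ gb) fx≡fy)

    j = τ (part (ga y))

    same-match : match j x ≡ match j y
    same-match = FP.combine-injectiveʳ j (match j x) j (match j y)
      (trans (sym (f-at same)) fx≡fy)

    same-rank : rankA x ≡ rankA y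
    same-rank = trans (sym (match-rank j x)) (trans (cong (rankB j) same-match) (match-rank j y))

  embedding : Embedding* (expand (toDigraph (n , EA)) a) (expand (toDigraph (C3Blowup (suc n))) b)
  embedding = labels⇒embedding ea eb f f-injective f-part f-≺

-- For A of size n the witness is B = C₃[I_{n+1}].
theorem5p7 : ExpansionProperty
theorem5p7 (n , EA) _ =
  C3Blowup (suc n) , C3Blowup∈Age (suc n) , λ a b ea eb → Construction.embedding ea eb
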